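{- Let $\Gamma$ be a simple graph of order $n$ whose degree sequence is $\delta_1\ge\delta_2\ge\cdots\ge\delta_n$, and let ${\cal L}(\Gamma)$ be its line graph. Then $$\left\lceil\frac{\delta_n+\delta_{n-1}}{2}\right\rceil\le \hat{a}({\cal L}(\Gamma))\le\delta_1 \quad\text{and}\quad \left\lceil\frac{\delta_n+\delta_{n-1}-1}{2}\right\rceil\le a({\cal L}(\Gamma))\le\delta_1 .$$ Moreover, if $\Gamma$ has a unique vertex of maximum degree, then $a({\cal L}(\Gamma))\le\delta_1-1$.
   Context: For a graph $G=(V,E)$, a set $S\subseteq V$ and a vertex $v$, let $N_S(v)$ be the set of neighbours of $v$ in $S$ and $N_{V\setminus S}(v)$ the set of neighbours of $v$ in $V\setminus S$; $\delta(v)$ denotes the degree of $v$. A nonempty set $S\subseteq V$ is a defensive alliance if $|N_S(v)|+1\ge |N_{V\setminus S}(v)|$ for every $v\in S$, and a strong defensive alliance if $|N_S(v)|\ge|N_{V\setminus S}(v)|$ for every $v\in S$. The defensive alliance number $a(G)$ (resp. strong defensive alliance number $\hat a(G)$) is the minimum cardinality of a defensive alliance (resp. strong defensive alliance) in $G$. The line graph ${\cal L}(\Gamma)$ has the edges of $\Gamma$ as vertices, two being adjacent when they share an endpoint; the degree of $e=\{u,v\}$ in ${\cal L}(\Gamma)$ is $\delta(u)+\delta(v)-2$. -}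

module Defs where

open import Data.Nat using (ℕ; zero; suc; _+_; _≤_)
open import Data.Bool using (Bool; true; false; _∧_; _∨_; not; if_then_else_)
open import Data.Fin using (Fin; _<?_; _≟_)
open import Data.List using (List; []; _∷_; length; filterᵇ; concatMap; allFin)
open import Data.List.Membership.Propositional using (_∈_)
open import Data.Product using (_×_; _,_; ∃; proj₁; proj₂)
open import Relation.Nullary.Decidable using (⌊_⌋)
open import Relation.Binary.PropositionalEquality using (_≡_)

count : {A : Set} → (A → Bool) → List A → ℕ
count p xs = length (filterᵇ p xs)

-- A finite graph presented by a duplicate-free enumeration `vs` of its
-- vertices and a Boolean adjacency relation.  A vertex subset is a Boolean
-- predicate S; only vertices in `vs` count.

module Alliance {V : Set} (vs : List V) (adj : V → V → Bool) where

  card : (V → Bool) → ℕ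
  card S = count S vs

  nIn : (V → Bool) → V → ℕ
  nIn S v = count (λ w → adj v w ∧ S w) vs

  nOut : (V → Bool) → V → ℕ
  nOut S v = count (λ w → adj v w ∧ not (S w)) vs

  IsDefensiveAlliance : (V → Bool) → Set
  IsDefensiveAlliance S =
    (1 ≤ card S) × (∀ v → v ∈ vs → S v ≡ true → nOut S v ≤ nIn S v + 1)

  IsStrongDefensiveAlliance : (V → Bool) → Set
  IsStrongDefensiveAlliance S =
    (1 ≤ card S) × (∀ v → v ∈ vs → S v ≡ true → nOut S v ≤ nIn S v)

record SimpleGraph (n : ℕ) : Set where
  field
    adj    : Fin n → Fin n → Bool
    sym    : ∀ u v → adj u v ≡ adj v u
    irrefl : ∀ v → adj v v ≡ false

open SimpleGraph public

degree : ∀ {n} → SimpleGraph n → Fin n → ℕ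
degree Γ v = count (adj Γ v) (allFin n)
  where n = _

HasEdge : ∀ {n} → SimpleGraph n → Set
HasEdge Γ = ∃ λ u → ∃ λ v → adj Γ u v ≡ true

-- Line graph.  Vertices are the edges {i,j} of Γ, each represented once as
-- the pair (i , j) with i < j.
_==_ : ∀ {n} → Fin n → Fin n → Bool
i == j = ⌊ i ≟ j ⌋

lineVertices : ∀ {n} → SimpleGraph n → List (Fin n × Fin n)
lineVertices {n} Γ =
  concatMap (λ i → concatMap (λ j →
      if ⌊ i <? j ⌋ ∧ adj Γ i j then (i , j) ∷ [] else []) (allFin n))
    (allFin n)

lineAdj : ∀ {n} → (Fin n × Fin n) → (Fin n × Fin n) → Bool
lineAdj (i , j) (k , l) =
  not ((i == k) ∧ (j == l)) ∧ ((i == k) ∨ (i == l) ∨ (j == k) ∨ (j == l))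

module LineGraph {n : ℕ} (Γ : SimpleGraph n) =
  Alliance (lineVertices Γ) (lineAdj {n})

{-# OPTIONS --safe #-}
-- An edge e = {u, v} of Γ has δ(u) + δ(v) − 2 neighbours in L(Γ). If e lies in an alliance S of
-- defect c (c = 0 strong, c = 1 defensive), then at most c more of them lie outside S than
-- inside, so S contains e and at least (δ(u) + δ(v) − 2 − c) / 2 further edges; since u ≠ v,
-- δ(u) + δ(v) ≥ δₙ + δₙ₋₁.  For the upper bounds take the star of a vertex w of maximum degree:
-- each of its edges {w, x} has δ₁ − 1 neighbours inside the star and δ(x) − 1 ≤ δ₁ − 1 outside.
-- If w is the only vertex of degree δ₁, deleting one edge {w, y} from the star leaves δ₁ − 1
-- edges, each {w, x} of which has δ₁ − 2 neighbours inside and δ(x) ≤ δ₁ − 1 outside.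
module Submission where

open import Defs
open import Data.Nat using (ℕ; suc; _+_; _∸_; _≤_; ⌈_/2⌉)
open import Data.Fin using (Fin; zero; fromℕ; inject₁)
open import Data.Fin.Permutation using (Permutation′; _⟨$⟩ʳ_)
open import Data.Product using (_×_; ∃)
open import Relation.Binary.PropositionalEquality using (_≡_)
import Data.Fin as F

open import Data.Bool using (Bool; true; false; _∧_; _∨_; not; T; if_then_else_)
open import Data.Bool.Properties using (T-≡; ∧-identityʳ; ∧-zeroʳ; ∨-zeroʳ; ∨-assoc)
open import Data.Empty using (⊥-elim)
open import Data.Fin using (toℕ)
open import Data.Fin.Permutation using (_⟨$⟩ˡ_; inverseʳ)
import Data.Fin.Properties as Fin
open import Data.List using (List; []; _∷_; _++_; length; concatMap; allFin)
open import Data.List.Properties using (filter-≐; length-++-sucʳ)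
open import Data.List.Membership.Propositional using (_∈_; find; lose)
open import Data.List.Membership.Propositional.Properties
  using (∈-∃++; ∈-++⁻; ∈-++⁺ˡ; ∈-++⁺ʳ; ∈-filter⁺; ∈-allFin; ∈-concatMap⁺; ∈-concatMap⁻)
open import Data.List.Relation.Unary.Any using (here; there)
import Data.List.Relation.Unary.All as All
open import Data.List.Relation.Unary.AllPairs using ([]; _∷_)
open import Data.List.Relation.Unary.Unique.Propositional using (Unique)
open import Data.List.Relation.Unary.Unique.Propositional.Properties using (++⁺; allFin⁺)
open import Data.Nat using (_<_; z≤n; s≤s; s≤s⁻¹; pred)
open import Data.Nat.Properties
  using (≤-trans; ≤-reflexive; ≤-antisym; +-suc; +-comm; +-mono-≤; +-monoˡ-≤; +-monoʳ-≤; ≮⇒≥; ≤∧≢⇒<;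
         m≤n⇒m≤1+n; m≤n⇒m≤n+o; m≤n+o⇒m∸n≤o; pred-mono-≤; ⌈n/2⌉-mono; n≡⌈n+n/2⌉; module ≤-Reasoning)
open import Data.Nat.Tactic.RingSolver using (solve)
open import Data.Product using (_,_; proj₁; proj₂; ∃₂)
open import Data.Product.Properties using (≡-dec)
open import Data.Sum using (_⊎_; inj₁; inj₂; swap)
open import Function using (_∘_)
open import Function.Bundles using (Equivalence)
open import Relation.Binary using (tri<; tri≈; tri>)
open import Relation.Binary.Definitions using (DecidableEquality)
open import Relation.Binary.PropositionalEquality
  using (refl; trans; cong; cong₂; subst; subst₂; _≢_; _≗_; module ≡-Reasoning)
import Relation.Binary.PropositionalEquality as ≡
open import Relation.Nullary using (¬_; yes; no; contradiction)
open import Relation.Nullary.Decidable using (⌊_⌋; T?; toWitness)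

∧-true⁻ : ∀ {a b} → a ∧ b ≡ true → a ≡ true × b ≡ true
∧-true⁻ {true}  {true}  _ = refl , refl
∧-true⁻ {true}  {false} ()
∧-true⁻ {false} ()

∨-true⁻ : ∀ {a b} → a ∨ b ≡ true → a ≡ true ⊎ b ≡ true
∨-true⁻ {true}          _ = inj₁ refl
∨-true⁻ {false} {true}  _ = inj₂ refl
∨-true⁻ {false} {false} ()

∈-++-skip : ∀ {A : Set} (xs : List A) {ys v w} → v ∈ xs ++ w ∷ ys → v ≢ w → v ∈ xs ++ ys
∈-++-skip xs v∈ v≢w with ∈-++⁻ xs v∈
... | inj₁ v∈xs         = ∈-++⁺ˡ v∈xs
... | inj₂ (here v≡w)   = ⊥-elim (v≢w v≡w)
... | inj₂ (there v∈ys) = ∈-++⁺ʳ xs v∈ys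

module _ {A : Set} where

  count-cong : ∀ {p q : A → Bool} → p ≗ q → ∀ xs → count p xs ≡ count q xs
  count-cong {p} {q} p≗q xs =
    cong length (filter-≐ (T? ∘ p) (T? ∘ q) ((λ {x} → subst T (p≗q x)) , (λ {x} → subst T (≡.sym (p≗q x))))
                          xs)

  count-split : ∀ (p q : A → Bool) xs →
                count (λ x → p x ∧ q x) xs + count (λ x → p x ∧ not (q x)) xs ≡ count p xs
  count-split p q [] = refl
  count-split p q (x ∷ xs) with p x | q x
  ... | true  | true  = cong suc (count-split p q xs)
  ... | true  | false = trans (+-suc _ _) (cong suc (count-split p q xs))
  ... | false | _     = count-split p q xs

  count-mono : ∀ {p q : A → Bool} xs → (∀ x → x ∈ xs → p x ≡ true → q x ≡ true) → count p xs ≤ count q xs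
  count-mono [] _ = z≤n
  count-mono {p} {q} (x ∷ xs) p⇒q with p x in px | q x in qx
  ... | true  | true  = s≤s (count-mono xs (λ y → p⇒q y ∘ there))
  ... | true  | false with () ← trans (≡.sym (p⇒q x (here refl) px)) qx
  ... | false | true  = m≤n⇒m≤1+n (count-mono xs (λ y → p⇒q y ∘ there))
  ... | false | false = count-mono xs (λ y → p⇒q y ∘ there)

  count-mono-< : ∀ {p q : A → Bool} {y} xs → (∀ x → p x ≡ true → q x ≡ true) →
                 y ∈ xs → p y ≡ false → q y ≡ true → count p xs < count q xs
  count-mono-< (x ∷ xs) p⇒q (here refl) py qy rewrite py | qy = s≤s (count-mono xs (λ z _ → p⇒q z))
  count-mono-< {p} {q} (x ∷ xs) p⇒q (there y∈xs) py qy with p x in px | q x in qx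
  ... | true  | true  = s≤s (count-mono-< xs p⇒q y∈xs py qy)
  ... | true  | false with () ← trans (≡.sym (p⇒q x px)) qx
  ... | false | true  = m≤n⇒m≤1+n (count-mono-< xs p⇒q y∈xs py qy)
  ... | false | false = count-mono-< xs p⇒q y∈xs py qy

  count-≤-suc : ∀ {p q : A → Bool} {y xs} → Unique xs → (∀ x → p x ≡ true → q x ≡ false → x ≡ y) →
                count p xs ≤ suc (count q xs)
  count-≤-suc {xs = []} _ _ = z≤n
  count-≤-suc {p} {q} {xs = x ∷ xs} (x∉xs ∷ u) only-y with p x in px | q x in qx
  ... | true  | true  = s≤s (count-≤-suc u only-y)
  ... | true  | false = s≤s (count-mono xs q-on-xs)
    where
    q-on-xs : ∀ z → z ∈ xs → p z ≡ true → q z ≡ true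
    q-on-xs z z∈xs pz with q z in qz
    ... | true  = refl
    ... | false with () ← All.lookup x∉xs z∈xs (trans (only-y x px qx) (≡.sym (only-y z pz qz)))
  ... | false | true  = m≤n⇒m≤1+n (count-≤-suc u only-y)
  ... | false | false = count-≤-suc u only-y

  count-some : ∀ {p : A → Bool} {x xs} → x ∈ xs → p x ≡ true → 0 < count p xs
  count-some (here refl) px rewrite px = s≤s z≤n
  count-some {p} {xs = y ∷ _} (there x∈xs) px with p y
  ... | true  = s≤s z≤n
  ... | false = count-some x∈xs px

  count-some⁻ : ∀ {p : A → Bool} xs → 0 < count p xs → ∃ λ x → x ∈ xs × p x ≡ true
  count-some⁻ {p} (x ∷ xs) pos with p x in px
  ... | true  = x , here refl , px
  ... | false = let y , y∈xs , py = count-some⁻ xs pos in y , there y∈xs , py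

module _ {A : Set} (_≟_ : DecidableEquality A) where

  count-─ : ∀ {p : A → Bool} {y xs} → Unique xs → y ∈ xs → p y ≡ true →
            suc (count (λ x → not ⌊ y ≟ x ⌋ ∧ p x) xs) ≡ count p xs
  count-─ {p} {y} {xs} u y∈xs py =
    ≤-antisym (count-mono-< xs (λ _ → proj₂ ∘ ∧-true⁻) y∈xs y-removed py) (count-≤-suc u only-y)
    where
    y-removed : not ⌊ y ≟ y ⌋ ∧ p y ≡ false
    y-removed with y ≟ y
    ... | yes _   = refl
    ... | no y≢y with () ← y≢y refl
    only-y : ∀ x → p x ≡ true → not ⌊ y ≟ x ⌋ ∧ p x ≡ false → x ≡ y
    only-y x px removed with y ≟ x
    ... | yes y≡x = ≡.sym y≡x
    ... | no _ with () ← trans (≡.sym px) removed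

module _ {A B : Set} where

  count-≤-injection : ∀ {p : A → Bool} {q : B → Bool} {xs ys} (f : A → B) (g : B → A) → Unique xs →
    (∀ x → x ∈ xs → p x ≡ true → f x ∈ ys × q (f x) ≡ true × g (f x) ≡ x) →
    count p xs ≤ count q ys
  count-≤-injection {p} {q} f g u into = count≤length u λ x x∈xs px →
      let fx∈ys , qfx , gfx = into x x∈xs px in ∈-filter⁺ (T? ∘ q) fx∈ys (Equivalence.from T-≡ qfx) , gfx
    where
    count≤length : ∀ {xs zs} → Unique xs → (∀ x → x ∈ xs → p x ≡ true → f x ∈ zs × g (f x) ≡ x) →
                   count p xs ≤ length zs
    count≤length {[]} _ _ = z≤n
    count≤length {x ∷ xs} (x∉xs ∷ u) into with p x in px
    ... | false = count≤length u (λ y → into y ∘ there)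
    ... | true with zs₁ , zs₂ , refl ← ∈-∃++ (proj₁ (into x (here refl) px)) =
      ≤-trans (s≤s (count≤length u into′)) (≤-reflexive (≡.sym (length-++-sucʳ zs₁ (f x) zs₂)))
      where
      into′ : ∀ y → y ∈ xs → p y ≡ true → f y ∈ zs₁ ++ zs₂ × g (f y) ≡ y
      into′ y y∈xs py =
        let fy∈ , gfy = into y (there y∈xs) py
            x≡y fy≡fx = trans (≡.sym (proj₂ (into x (here refl) px))) (trans (cong g (≡.sym fy≡fx)) gfy)
        in ∈-++-skip zs₁ fy∈ (All.lookup x∉xs y∈xs ∘ x≡y) , gfy

concatMap-unique : ∀ {A B : Set} {F : A → List B} (key : B → A) {xs} → Unique xs →
  (∀ a → Unique (F a)) → (∀ a {b} → b ∈ F a → key b ≡ a) → Unique (concatMap F xs)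
concatMap-unique key {[]} _ _ _ = []
concatMap-unique {F = F} key {x ∷ xs} (x∉xs ∷ u) F-unique keyed =
  ++⁺ (F-unique x) (concatMap-unique key u F-unique keyed) disjoint
  where
  disjoint : ∀ {b} → ¬ (b ∈ F x × b ∈ concatMap F xs)
  disjoint (b∈Fx , b∈rest) with a , a∈xs , b∈Fa ← find (∈-concatMap⁻ F b∈rest) =
    All.lookup x∉xs a∈xs (trans (≡.sym (keyed x b∈Fx)) (keyed a b∈Fa))

module _ {A : Set} where

  ∈-if-singleton⁻ : ∀ c {x y : A} → y ∈ (if c then x ∷ [] else []) → c ≡ true × y ≡ x
  ∈-if-singleton⁻ true (here y≡x) = refl , y≡x

  if-singleton-unique : ∀ c {x : A} → Unique (if c then x ∷ [] else [])
  if-singleton-unique true  = All.[] ∷ []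
  if-singleton-unique false = []

module AllianceProperties {V : Set} (vs : List V) (adj : V → V → Bool) where

  open Alliance vs adj

  strong⇒defensive : ∀ {S} → IsStrongDefensiveAlliance S → IsDefensiveAlliance S
  strong⇒defensive (nonempty , defended) = nonempty , λ v v∈vs Sv → m≤n⇒m≤n+o 1 (defended v v∈vs Sv)

  degree-bound : ∀ {S v} c → v ∈ vs → adj v v ≡ false → S v ≡ true → nOut S v ≤ nIn S v + c →
                 count (adj v) vs + 2 ≤ card S + card S + c
  degree-bound {S} {v} c v∈vs vv Sv defended = begin
      count (adj v) vs + 2                ≡⟨ cong (_+ 2) (≡.sym (count-split (adj v) S vs)) ⟩
      nIn S v + nOut S v + 2              ≤⟨ +-monoˡ-≤ 2 (+-monoʳ-≤ (nIn S v) defended) ⟩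
      nIn S v + (nIn S v + c) + 2         ≡⟨ rearrange (nIn S v) ⟩
      suc (nIn S v) + suc (nIn S v) + c   ≤⟨ +-monoˡ-≤ c (+-mono-≤ nIn<card nIn<card) ⟩
      card S + card S + c                 ∎
    where
    open ≤-Reasoning
    rearrange : ∀ a → a + (a + c) + 2 ≡ suc a + suc a + c
    rearrange a = solve (a ∷ c ∷ [])
    nIn<card : nIn S v < card S
    nIn<card = count-mono-< vs (λ _ → proj₂ ∘ ∧-true⁻) v∈vs (cong (_∧ S v) vv) Sv

  module Removal (_≟_ : DecidableEquality V) (unique : Unique vs) where

    _─_ : (V → Bool) → V → V → Bool
    (S ─ g) v = not ⌊ g ≟ v ⌋ ∧ S v

    card-─ : ∀ {S g} → g ∈ vs → S g ≡ true → suc (card (S ─ g)) ≡ card S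
    card-─ = count-─ _≟_ unique

    nIn-─ : ∀ S g v → nIn S v ≤ suc (nIn (S ─ g) v)
    nIn-─ S g v = count-≤-suc unique only-g
      where
      only-g : ∀ u → adj v u ∧ S u ≡ true → adj v u ∧ (S ─ g) u ≡ false → u ≡ g
      only-g u in-S not-in-S─g with g ≟ u
      ... | yes g≡u = ≡.sym g≡u
      ... | no _ with () ← trans (≡.sym in-S) not-in-S─g

    nOut-─ : ∀ S g v → nOut (S ─ g) v ≤ suc (nOut S v)
    nOut-─ S g v = count-≤-suc unique only-g
      where
      only-g : ∀ u → adj v u ∧ not ((S ─ g) u) ≡ true → adj v u ∧ not (S u) ≡ false → u ≡ g
      only-g u out-S─g not-out-S with g ≟ u
      ... | yes g≡u = ≡.sym g≡u
      ... | no _ with () ← trans (≡.sym out-S─g) not-out-S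

Edge : ℕ → Set
Edge n = Fin n × Fin n

module _ {n : ℕ} where

  ==-refl : ∀ (i : Fin n) → (i == i) ≡ true
  ==-refl i with i F.≟ i
  ... | yes _   = refl
  ... | no i≢i = ⊥-elim (i≢i refl)

  -- Opaque so that arguments of star, edge and other can be inferred by unification; unfolded,
  -- they reduce (by η on pairs) to Boolean expressions that hide their arguments.
  opaque

    star : Fin n → Edge n → Bool
    star z (i , j) = (z == i) ∨ (z == j)

    edge : Fin n → Fin n → Edge n
    edge a b with a F.<? b
    ... | yes _ = a , b
    ... | no _  = b , a

    other : Fin n → Edge n → Fin n
    other z (i , j) with z F.≟ i
    ... | yes _ = j
    ... | no _  = i

    star-fst : ∀ {i j : Fin n} → star i (i , j) ≡ true
    star-fst {i} rewrite ==-refl i = refl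

    star-snd : ∀ {i j : Fin n} → star j (i , j) ≡ true
    star-snd {i} {j} rewrite ==-refl j = ∨-zeroʳ (j == i)

    star⁻ : ∀ {z i j : Fin n} → star z (i , j) ≡ true → z ≡ i ⊎ z ≡ j
    star⁻ {z} {i} {j} h with z F.≟ i | z F.≟ j
    ... | yes z≡i | _       = inj₁ z≡i
    ... | no _    | yes z≡j = inj₂ z≡j
    ... | no _    | no _    with () ← h

    lineAdj-via-star : ∀ {i j k l : Fin n} →
      lineAdj (i , j) (k , l) ≡ not ((i == k) ∧ (j == l)) ∧ (star i (k , l) ∨ star j (k , l))
    lineAdj-via-star {i} {j} {k} {l} =
      cong (not ((i == k) ∧ (j == l)) ∧_) (≡.sym (∨-assoc (i == k) (i == l) _))

    other-fst : ∀ {i j : Fin n} → other i (i , j) ≡ j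
    other-fst {i} with i F.≟ i
    ... | yes _   = refl
    ... | no i≢i = ⊥-elim (i≢i refl)

    other-snd : ∀ {i j : Fin n} → other j (i , j) ≡ i
    other-snd {i} {j} with j F.≟ i
    ... | yes j≡i = j≡i
    ... | no _    = refl

    edge-< : ∀ {a b : Fin n} → a F.< b → edge a b ≡ (a , b)
    edge-< {a} {b} a<b with a F.<? b
    ... | yes _   = refl
    ... | no a≮b = ⊥-elim (a≮b a<b)

    edge-≮ : ∀ {a b : Fin n} → ¬ a F.< b → edge a b ≡ (b , a)
    edge-≮ {a} {b} a≮b with a F.<? b
    ... | yes a<b = ⊥-elim (a≮b a<b)
    ... | no _    = refl

    star-edgeˡ : ∀ {a b : Fin n} → star a (edge a b) ≡ true
    star-edgeˡ {a} {b} with a F.<? b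
    ... | yes _ = star-fst {a} {b}
    ... | no _  = star-snd {b} {a}

    star-edgeʳ : ∀ {a b : Fin n} → star b (edge a b) ≡ true
    star-edgeʳ {a} {b} with a F.<? b
    ... | yes _ = star-snd {a} {b}
    ... | no _  = star-fst {b} {a}

    star-edge⁻ : ∀ {z a b : Fin n} → star z (edge a b) ≡ true → z ≡ a ⊎ z ≡ b
    star-edge⁻ {z} {a} {b} h with a F.<? b
    ... | yes _ = star⁻ {z} {a} {b} h
    ... | no _  = swap (star⁻ {z} {b} {a} h)

    other-edge : ∀ {a b : Fin n} → other a (edge a b) ≡ b
    other-edge {a} {b} with a F.<? b
    ... | yes _ = other-fst {a} {b}
    ... | no _  = other-snd {b} {a}

  star-edge-≢ : ∀ {w x k : Fin n} → w ≢ x → star w (edge x k) ≡ (w == k)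
  star-edge-≢ {w} {x} {k} w≢x with w F.≟ k
  ... | yes refl = star-edgeʳ
  ... | no w≢k with star w (edge x k) in wxk
  ...   | false = refl
  ...   | true with star-edge⁻ wxk
  ...     | inj₁ w≡x = ⊥-elim (w≢x w≡x)
  ...     | inj₂ w≡k = ⊥-elim (w≢k w≡k)

  lineAdj-irrefl : ∀ (e : Edge n) → lineAdj e e ≡ false
  lineAdj-irrefl (i , j) rewrite ==-refl i | ==-refl j = refl

  lineAdj-shared : ∀ {e f : Edge n} {z} → e ≢ f → star z e ≡ true → star z f ≡ true → lineAdj e f ≡ true
  lineAdj-shared {i , j} {k , l} {z} e≢f ze zf =
    trans (lineAdj-via-star {i} {j} {k} {l}) (cong₂ _∧_ distinct shared)
    where
    distinct : not ((i == k) ∧ (j == l)) ≡ true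
    distinct with i F.≟ k | j F.≟ l
    ... | yes refl | yes refl = ⊥-elim (e≢f refl)
    ... | yes _    | no _     = refl
    ... | no _     | _        = refl
    shared : star i (k , l) ∨ star j (k , l) ≡ true
    shared with star⁻ {z} {i} {j} ze
    ... | inj₁ refl = cong (_∨ star j (k , l)) zf
    ... | inj₂ refl = trans (cong (star i (k , l) ∨_) zf) (∨-zeroʳ _)

  lineAdj⇒shared : ∀ {e f : Edge n} → lineAdj e f ≡ true → ∃ λ z → star z e ≡ true × star z f ≡ true
  lineAdj⇒shared {i , j} {k , l} ef
    with ∨-true⁻ (proj₂ (∧-true⁻ (trans (≡.sym (lineAdj-via-star {i} {j} {k} {l})) ef)))
  ... | inj₁ iₑ = i , star-fst , iₑ
  ... | inj₂ jₑ = j , star-snd , jₑ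

  lineAdj-edge : ∀ {w x k : Fin n} → lineAdj (edge w x) (edge w k) ≡ not (x == k)
  lineAdj-edge {w} {x} {k} with x F.≟ k
  ... | yes refl = lineAdj-irrefl (edge w x)
  ... | no x≢k   = lineAdj-shared (x≢k ∘ edge-injective) star-edgeˡ star-edgeˡ
    where
    edge-injective : edge w x ≡ edge w k → x ≡ k
    edge-injective eq = trans (≡.sym other-edge) (trans (cong (other w) eq) other-edge)

  lineAdj-off-star : ∀ {w x : Fin n} f → lineAdj (edge w x) f ∧ not (star w f) ≡ not (star w f) ∧ star x f
  lineAdj-off-star {w} {x} f with star w f in wf
  ... | true  = ∧-zeroʳ _
  ... | false = trans (∧-identityʳ _) adjacent⇔x
    where
    adjacent⇔x : lineAdj (edge w x) f ≡ star x f
    adjacent⇔x with star x f in xf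
    ... | true = lineAdj-shared e≢f star-edgeʳ xf
      where
      e≢f : edge w x ≢ f
      e≢f e≡f = contradiction (trans (≡.sym star-edgeˡ) (trans (cong (star w) e≡f) wf)) λ ()
    ... | false with lineAdj (edge w x) f in ef
    ...   | false = refl
    ...   | true with z , ze , zf ← lineAdj⇒shared ef with star-edge⁻ {z} {w} {x} ze
    ...     | inj₁ refl with () ← trans (≡.sym zf) wf
    ...     | inj₂ refl with () ← trans (≡.sym zf) xf

module LineGraphProperties {n : ℕ} (Γ : SimpleGraph n) where

  open LineGraph Γ
  open AllianceProperties (lineVertices Γ) lineAdj public

  adj-sym : ∀ {a b} → adj Γ a b ≡ true → adj Γ b a ≡ true
  adj-sym {a} {b} ab = trans (SimpleGraph.sym Γ b a) ab

  adj⇒≢ : ∀ {a b} → adj Γ a b ≡ true → a ≢ b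
  adj⇒≢ {a} aa refl with () ← trans (≡.sym aa) (irrefl Γ a)

  private
    row : Fin n → List (Edge n)
    row i = concatMap (λ j → if ⌊ i F.<? j ⌋ ∧ adj Γ i j then (i , j) ∷ [] else []) (allFin n)

    ∈-row⁻ : ∀ {i e} → e ∈ row i → ∃ λ j → ⌊ i F.<? j ⌋ ∧ adj Γ i j ≡ true × e ≡ (i , j)
    ∈-row⁻ e∈ with j , _ , e∈′ ← find (∈-concatMap⁻ _ {xs = allFin n} e∈) = j , ∈-if-singleton⁻ _ e∈′

  lineVertices-unique : Unique (lineVertices Γ)
  lineVertices-unique =
    concatMap-unique proj₁ (allFin⁺ n) row-unique (λ _ → cong proj₁ ∘ proj₂ ∘ proj₂ ∘ ∈-row⁻)
    where
    row-unique : ∀ i → Unique (row i)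
    row-unique i = concatMap-unique proj₂ (allFin⁺ n) (λ _ → if-singleton-unique _)
                                    (λ _ → cong proj₂ ∘ proj₂ ∘ ∈-if-singleton⁻ _)

  ∈-lineVertices⁺ : ∀ {i j} → i F.< j → adj Γ i j ≡ true → (i , j) ∈ lineVertices Γ
  ∈-lineVertices⁺ {i} {j} i<j ij =
    ∈-concatMap⁺ row (lose (∈-allFin i) (∈-concatMap⁺ _ (lose (∈-allFin j) chosen)))
    where
    chosen : (i , j) ∈ (if ⌊ i F.<? j ⌋ ∧ adj Γ i j then (i , j) ∷ [] else [])
    chosen with i F.<? j
    ... | yes _   rewrite ij = here refl
    ... | no i≮j = ⊥-elim (i≮j i<j)

  ∈-lineVertices⁻ : ∀ {i j} → (i , j) ∈ lineVertices Γ → i F.< j × adj Γ i j ≡ true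
  ∈-lineVertices⁻ e∈ with i , _ , e∈row ← find (∈-concatMap⁻ row {xs = allFin n} e∈) with ∈-row⁻ e∈row
  ... | j , ij , refl = let i<j , adj-ij = ∧-true⁻ ij in toWitness (Equivalence.from T-≡ i<j) , adj-ij

  edge∈lineVertices : ∀ {a b} → adj Γ a b ≡ true → edge a b ∈ lineVertices Γ
  edge∈lineVertices {a} {b} ab with a F.<? b
  ... | yes a<b rewrite edge-< a<b = ∈-lineVertices⁺ a<b ab
  ... | no a≮b  rewrite edge-≮ a≮b = ∈-lineVertices⁺ (Fin.≤∧≢⇒< (≮⇒≥ a≮b) (adj⇒≢ ab ∘ ≡.sym)) (adj-sym ab)

  ∈-lineVertices⇒edge : ∀ {e} → e ∈ lineVertices Γ → ∃₂ λ i j → adj Γ i j ≡ true × edge i j ≡ e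
  ∈-lineVertices⇒edge {i , j} e∈ = let i<j , ij = ∈-lineVertices⁻ e∈ in i , j , ij , edge-< i<j

  ∈-lineVertices-star : ∀ {z e} → e ∈ lineVertices Γ → star z e ≡ true →
                        ∃ λ x → adj Γ z x ≡ true × edge z x ≡ e
  ∈-lineVertices-star {z} {i , j} e∈ ze with ∈-lineVertices⁻ e∈ | star⁻ {z = z} {i} {j} ze
  ... | i<j , ij | inj₁ refl = j , ij , edge-< i<j
  ... | i<j , ij | inj₂ refl = i , adj-sym ij , edge-≮ (Fin.<-asym i<j)

  star-count : ∀ z (P : Edge n → Bool) →
    count (λ e → P e ∧ star z e) (lineVertices Γ) ≡ count (λ k → P (edge z k) ∧ adj Γ z k) (allFin n)
  star-count z P = ≤-antisym
      (count-≤-injection (other z) (edge z) lineVertices-unique endpoint)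
      (count-≤-injection (edge z) (other z) (allFin⁺ n) incident)
    where
    endpoint : ∀ e → e ∈ lineVertices Γ → P e ∧ star z e ≡ true →
               other z e ∈ allFin n × P (edge z (other z e)) ∧ adj Γ z (other z e) ≡ true ×
               edge z (other z e) ≡ e
    endpoint e e∈ Pe∧ze with Pe , ze ← ∧-true⁻ Pe∧ze with x , zx , refl ← ∈-lineVertices-star {z = z} e∈ ze
      rewrite other-edge {a = z} {x} = ∈-allFin x , cong₂ _∧_ Pe zx , refl
    incident : ∀ k → k ∈ allFin n → P (edge z k) ∧ adj Γ z k ≡ true →
               edge z k ∈ lineVertices Γ × P (edge z k) ∧ star z (edge z k) ≡ true × other z (edge z k) ≡ k
    incident k _ Pk∧zk with Pk , zk ← ∧-true⁻ Pk∧zk =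
      edge∈lineVertices zk , cong₂ _∧_ Pk star-edgeˡ , other-edge

  card-star : ∀ w → card (star w) ≡ degree Γ w
  card-star w = star-count w (λ _ → true)

  nIn-star : ∀ {w x} → adj Γ w x ≡ true → suc (nIn (star w) (edge w x)) ≡ degree Γ w
  nIn-star {w} {x} wx = trans (cong suc neighbours) (count-─ F._≟_ (allFin⁺ n) (∈-allFin x) wx)
    where
    open ≡-Reasoning
    neighbours : nIn (star w) (edge w x) ≡ count (λ k → not (x == k) ∧ adj Γ w k) (allFin n)
    neighbours = begin
      count (λ f → lineAdj (edge w x) f ∧ star w f) (lineVertices Γ)
        ≡⟨ star-count w (lineAdj (edge w x)) ⟩
      count (λ k → lineAdj (edge w x) (edge w k) ∧ adj Γ w k) (allFin n)
        ≡⟨ count-cong (λ k → cong (_∧ adj Γ w k) (lineAdj-edge {w = w} {x} {k})) (allFin n) ⟩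
      count (λ k → not (x == k) ∧ adj Γ w k) (allFin n)
        ∎

  nOut-star : ∀ {w x} → adj Γ w x ≡ true → suc (nOut (star w) (edge w x)) ≡ degree Γ x
  nOut-star {w} {x} wx = trans (cong suc neighbours) (count-─ F._≟_ (allFin⁺ n) (∈-allFin w) (adj-sym wx))
    where
    open ≡-Reasoning
    w≢x = adj⇒≢ wx
    neighbours : nOut (star w) (edge w x) ≡ count (λ k → not (w == k) ∧ adj Γ x k) (allFin n)
    neighbours = begin
      count (λ f → lineAdj (edge w x) f ∧ not (star w f)) (lineVertices Γ)
        ≡⟨ count-cong (lineAdj-off-star {w = w} {x}) (lineVertices Γ) ⟩
      count (λ f → not (star w f) ∧ star x f) (lineVertices Γ)
        ≡⟨ star-count x (not ∘ star w) ⟩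
      count (λ k → not (star w (edge x k)) ∧ adj Γ x k) (allFin n)
        ≡⟨ count-cong (λ k → cong (λ b → not b ∧ adj Γ x k) (star-edge-≢ {w = w} {x} {k} w≢x)) (allFin n) ⟩
      count (λ k → not (w == k) ∧ adj Γ x k) (allFin n)
        ∎

  edge-degree : ∀ {i j} → adj Γ i j ≡ true →
                count (lineAdj (edge i j)) (lineVertices Γ) + 2 ≡ degree Γ i + degree Γ j
  edge-degree {i} {j} ij = begin
      count (lineAdj e) (lineVertices Γ) + 2
        ≡⟨ cong (_+ 2) (≡.sym (count-split (lineAdj e) (star i) (lineVertices Γ))) ⟩
      nIn (star i) e + nOut (star i) e + 2
        ≡⟨ rearrange (nIn (star i) e) (nOut (star i) e) ⟩
      suc (nIn (star i) e) + suc (nOut (star i) e)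
        ≡⟨ cong₂ _+_ (nIn-star ij) (nOut-star ij) ⟩
      degree Γ i + degree Γ j
        ∎
    where
    open ≡-Reasoning
    e = edge i j
    rearrange : ∀ a b → a + b + 2 ≡ suc a + suc b
    rearrange a b = solve (a ∷ b ∷ [])

  card-lower-bound : ∀ {S} L c → (∀ u v → u ≢ v → L ≤ degree Γ u + degree Γ v) → 0 < card S →
    (∀ e → e ∈ lineVertices Γ → S e ≡ true → nOut S e ≤ nIn S e + c) → ⌈ L ∸ c /2⌉ ≤ card S
  card-lower-bound {S} L c degrees nonempty defended
    with e , e∈ , Se ← count-some⁻ (lineVertices Γ) nonempty
    with i , j , ij , refl ← ∈-lineVertices⇒edge e∈ = begin
      ⌈ L ∸ c /2⌉              ≤⟨ ⌈n/2⌉-mono (m≤n+o⇒m∸n≤o L c L≤c+2|S|) ⟩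
      ⌈ card S + card S /2⌉   ≡⟨ ≡.sym (n≡⌈n+n/2⌉ (card S)) ⟩
      card S                  ∎
    where
    open ≤-Reasoning
    L≤c+2|S| : L ≤ c + (card S + card S)
    L≤c+2|S| = begin
      L                                        ≤⟨ degrees i j (adj⇒≢ ij) ⟩
      degree Γ i + degree Γ j                  ≡⟨ ≡.sym (edge-degree ij) ⟩
      count (lineAdj e) (lineVertices Γ) + 2   ≤⟨ degree-bound c e∈ (lineAdj-irrefl e) Se (defended e e∈ Se) ⟩
      card S + card S + c                      ≡⟨ +-comm _ c ⟩
      c + (card S + card S)                    ∎

  star-isStrongDefensiveAlliance : ∀ {w y} → adj Γ w y ≡ true → (∀ v → degree Γ v ≤ degree Γ w) →
                                   IsStrongDefensiveAlliance (star w)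
  star-isStrongDefensiveAlliance {w} wy maximal = count-some (edge∈lineVertices wy) star-edgeˡ , defended
    where
    defended : ∀ e → e ∈ lineVertices Γ → star w e ≡ true → nOut (star w) e ≤ nIn (star w) e
    defended e e∈ we with x , wx , refl ← ∈-lineVertices-star {z = w} e∈ we =
      s≤s⁻¹ (subst₂ _≤_ (≡.sym (nOut-star wx)) (≡.sym (nIn-star wx)) (maximal x))

  open Removal (≡-dec F._≟_ F._≟_) lineVertices-unique public

  card-star─edge : ∀ {w y} → adj Γ w y ≡ true → suc (card (star w ─ edge w y)) ≡ degree Γ w
  card-star─edge {w} wy = trans (card-─ (edge∈lineVertices wy) star-edgeˡ) (card-star w)

  star─edge-isDefensiveAlliance : ∀ {w y} → adj Γ w y ≡ true → (∀ v → v ≢ w → degree Γ v < degree Γ w) →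
                                  IsDefensiveAlliance (star w ─ edge w y)
  star─edge-isDefensiveAlliance {w} {y} wy unique-max = nonempty , defended
    where
    open ≤-Reasoning
    nonempty : 0 < card (star w ─ edge w y)
    nonempty = s≤s⁻¹ (begin
      2                                 ≤⟨ s≤s (count-some (∈-allFin w) (adj-sym wy)) ⟩
      suc (degree Γ y)                  ≤⟨ unique-max y (adj⇒≢ wy ∘ ≡.sym) ⟩
      degree Γ w                        ≡⟨ ≡.sym (card-star─edge wy) ⟩
      suc (card (star w ─ edge w y))    ∎)
    defended : ∀ e → e ∈ lineVertices Γ → (star w ─ edge w y) e ≡ true →
               nOut (star w ─ edge w y) e ≤ nIn (star w ─ edge w y) e + 1
    defended e e∈ S′e with x , wx , refl ← ∈-lineVertices-star {z = w} e∈ (proj₂ (∧-true⁻ S′e)) = begin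
      nOut (star w ─ edge w y) (edge w x)     ≤⟨ nOut-─ (star w) (edge w y) (edge w x) ⟩
      suc (nOut (star w) (edge w x))          ≡⟨ nOut-star wx ⟩
      degree Γ x                              ≤⟨ pred-mono-≤ (unique-max x (adj⇒≢ wx ∘ ≡.sym)) ⟩
      pred (degree Γ w)                       ≡⟨ cong pred (≡.sym (nIn-star wx)) ⟩
      nIn (star w) (edge w x)                 ≤⟨ nIn-─ (star w) (edge w y) (edge w x) ⟩
      suc (nIn (star w ─ edge w y) (edge w x)) ≡⟨ +-comm 1 _ ⟩
      nIn (star w ─ edge w y) (edge w x) + 1  ∎

module _ {m : ℕ} (d : Fin (suc (suc m)) → ℕ) (antitone : ∀ i j → i F.≤ j → d j ≤ d i) where

  private
    last-two-sum≤ : ∀ {i j} → i F.< j → d (fromℕ (suc m)) + d (inject₁ (fromℕ m)) ≤ d j + d i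
    last-two-sum≤ {i} {j} i<j = +-mono-≤ (antitone j _ (Fin.≤fromℕ j)) (antitone i _ i≤m)
      where
      i≤m : i F.≤ inject₁ (fromℕ m)
      i≤m = subst (toℕ i ≤_) (≡.sym (Fin.toℕ-inject₁ (fromℕ m))) (s≤s⁻¹ (≤-trans i<j (Fin.≤fromℕ j)))

  antitone-last-two-minimal : ∀ i j → i ≢ j → d (fromℕ (suc m)) + d (inject₁ (fromℕ m)) ≤ d i + d j
  antitone-last-two-minimal i j i≢j with Fin.<-cmp i j
  ... | tri< i<j _ _ = ≤-trans (last-two-sum≤ i<j) (≤-reflexive (+-comm (d j) (d i)))
  ... | tri≈ _ i≡j _ = ⊥-elim (i≢j i≡j)
  ... | tri> _ _ j<i = last-two-sum≤ j<i

module SortedDegrees {m : ℕ} (Γ : SimpleGraph (suc (suc m))) (π : Permutation′ (suc (suc m)))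
  (antitone : ∀ i j → i F.≤ j → degree Γ (π ⟨$⟩ʳ j) ≤ degree Γ (π ⟨$⟩ʳ i)) where

  private
    δ : Fin (suc (suc m)) → ℕ
    δ = degree Γ ∘ (π ⟨$⟩ʳ_)

    degree≡δ : ∀ a → degree Γ a ≡ δ (π ⟨$⟩ˡ a)
    degree≡δ a = cong (degree Γ) (≡.sym (inverseʳ π))

    π⁻¹-injective : ∀ {a b} → π ⟨$⟩ˡ a ≡ π ⟨$⟩ˡ b → a ≡ b
    π⁻¹-injective eq = trans (≡.sym (inverseʳ π)) (trans (cong (π ⟨$⟩ʳ_) eq) (inverseʳ π))

  degree≤δ₁ : ∀ a → degree Γ a ≤ δ zero
  degree≤δ₁ a = subst (_≤ δ zero) (≡.sym (degree≡δ a)) (antitone zero (π ⟨$⟩ˡ a) z≤n)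

  δₙ+δₙ₋₁≤ : ∀ a b → a ≢ b → δ (fromℕ (suc m)) + δ (inject₁ (fromℕ m)) ≤ degree Γ a + degree Γ b
  δₙ+δₙ₋₁≤ a b a≢b = subst₂ (λ da db → _ ≤ da + db) (≡.sym (degree≡δ a)) (≡.sym (degree≡δ b))
    (antitone-last-two-minimal δ antitone _ _ (a≢b ∘ π⁻¹-injective))

mainTheorem1 : (m : ℕ) (Γ : SimpleGraph (suc (suc m))) → HasEdge Γ →
    (π : Permutation′ (suc (suc m))) →
    (∀ i j → i F.≤ j → degree Γ (π ⟨$⟩ʳ j) ≤ degree Γ (π ⟨$⟩ʳ i)) →
    let δ₁   = degree Γ (π ⟨$⟩ʳ zero)
        δₙ   = degree Γ (π ⟨$⟩ʳ fromℕ (suc m))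
        δₙ₋₁ = degree Γ (π ⟨$⟩ʳ inject₁ (fromℕ m))
        open LineGraph Γ
    in ((∀ S → IsStrongDefensiveAlliance S → ⌈ δₙ + δₙ₋₁ /2⌉ ≤ card S)
        × (∃ λ S → IsStrongDefensiveAlliance S × card S ≤ δ₁))
     × ((∀ S → IsDefensiveAlliance S → ⌈ δₙ + δₙ₋₁ ∸ 1 /2⌉ ≤ card S)
        × (∃ λ S → IsDefensiveAlliance S × card S ≤ δ₁))
     × ((∀ u v → degree Γ u ≡ δ₁ → degree Γ v ≡ δ₁ → u ≡ v) →
        ∃ λ S → IsDefensiveAlliance S × card S ≤ δ₁ ∸ 1)
mainTheorem1 m Γ (u , v , uv) π antitone =
    ( (λ S (nonempty , defended) →
         card-lower-bound _ 0 δₙ+δₙ₋₁≤ nonempty λ e e∈ Se → m≤n⇒m≤n+o 0 (defended e e∈ Se))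
    , (star w , strong-star , ≤-reflexive (card-star w)))
  , ( (λ S (nonempty , defended) → card-lower-bound _ 1 δₙ+δₙ₋₁≤ nonempty defended)
    , (star w , strong⇒defensive strong-star , ≤-reflexive (card-star w)))
  , λ w-unique →
      star w ─ edge w y
    , star─edge-isDefensiveAlliance wy
        (λ a a≢w → ≤∧≢⇒< (degree≤δ₁ a) (λ da≡dw → a≢w (w-unique a w da≡dw refl)))
    , ≤-reflexive (cong (_∸ 1) (card-star─edge wy))
  where
  open LineGraph Γ
  open LineGraphProperties Γ
  open SortedDegrees Γ π antitone

  w = π ⟨$⟩ʳ zero

  neighbour : ∃ λ y → y ∈ allFin _ × adj Γ w y ≡ true
  neighbour = count-some⁻ (allFin _) (≤-trans (count-some {p = adj Γ u} (∈-allFin v) uv) (degree≤δ₁ u))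

  y = proj₁ neighbour
  wy = proj₂ (proj₂ neighbour)

  strong-star : IsStrongDefensiveAlliance (star w)
  strong-star = star-isStrongDefensiveAlliance wy degree≤δ₁
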